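{- Let $n$ be an even positive integer and $k$ a positive integer with $k<n$ and $k$ dividing $n$. Then the path $P_{2k}$ divides the hypercube $Q_n$.
   Context: $Q_n$ is the $n$-dimensional hypercube: vertex set the subsets of $\{1,\ldots,n\}$, with $x,y$ adjacent iff $|x\,\Delta\, y|=1$. $P_m$ denotes the path with $m$ edges. If $H$ is isomorphic to a subgraph of $G$, $H$ divides $G$ if there exist embeddings $\theta_1,\ldots,\theta_r$ of $H$ into $G$ such that $\{E(\theta_1(H)),\ldots,E(\theta_r(H))\}$ is a partition of $E(G)$. -}

module Defs where

open import Data.Nat using (ℕ; suc)
open import Data.Fin using (Fin; inject₁) renaming (suc to fsuc)
open import Data.Fin.Subset using (Subset; _∪_; _─_; ∣_∣)
open import Data.Product using (Σ; _×_; _,_; ∃)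
open import Data.Sum using (_⊎_)
open import Function.Definitions using (Injective)
open import Relation.Binary.PropositionalEquality using (_≡_)

-- Vertices of the hypercube Q_n: subsets of {1,…,n}, i.e. Subset n.
-- Symmetric difference x Δ y.
_Δ_ : {n : ℕ} → Subset n → Subset n → Subset n
x Δ y = (x ─ y) ∪ (y ─ x)

Adjacent : {n : ℕ} → Subset n → Subset n → Set
Adjacent x y = ∣ x Δ y ∣ ≡ 1

SameEdge : {n : ℕ} → Subset n → Subset n → Subset n → Subset n → Set
SameEdge a b x y = (a ≡ x × b ≡ y) ⊎ (a ≡ y × b ≡ x)

-- An embedding of the path P_m (vertices 0,…,m, edges {i,i+1}) into Q_n:
-- an injective vertex map sending path edges to hypercube edges.
record PathEmbedding (m n : ℕ) : Set where
  field
    vertex    : Fin (suc m) → Subset n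
    injective : Injective _≡_ _≡_ vertex
    adjacent  : (i : Fin m) → Adjacent (vertex (inject₁ i)) (vertex (fsuc i))

open PathEmbedding public

EdgeOf : {m n : ℕ} → PathEmbedding m n → Subset n → Subset n → Set
EdgeOf {m} θ x y = ∃ λ (i : Fin m) → SameEdge (vertex θ (inject₁ i)) (vertex θ (fsuc i)) x y

PathDividesCube : ℕ → ℕ → Set
PathDividesCube m n =
  Σ ℕ λ r → Σ (Fin r → PathEmbedding m n) λ θ →
    (x y : Subset n) → Adjacent x y →
      (∃ λ (j : Fin r) → EdgeOf (θ j) x y) ×
      ((j j′ : Fin r) → EdgeOf (θ j) x y → EdgeOf (θ j′) x y → j ≡ j′)

module Submission where

-- P_{2k} divides Q_n whenever k is a proper divisor of n.
--
-- Write n = m·k with m ≥ 2 and arrange the coordinates of Q_n in an m × k grid;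
-- fix a fixed-point-free permutation `next` of the rows.  For a row a and a
-- start vertex v, the path of type a from v flips the cells of row a from left
-- to right and then those of row next a: an embedded P_{2k}.  Call (a , v) valid
-- if the parity of v outside row a is even while the parity of the middle
-- vertex outside row next a is odd.  A flip in direction c preserves the parity
-- outside row c; along a valid path of type a this parity is even on the edges
-- of the first half and odd on those of the second half.  Hence an edge
-- determines the type of a valid path through it, then the time at which it is
-- traversed, and finally (by the parity conditions) the start.  Conversely
-- every edge lies on some valid path, so the valid paths partition E(Q_n).

open import Defs
open import Data.Bool as Bool using (Bool; true; false; not; _xor_; _∧_)
open import Data.Bool.Properties using (xor-assoc; xor-comm; xor-same; xor-identityʳ; not-¬)
open import Data.Empty using (⊥-elim)
open import Data.Fin
  using (Fin; toℕ; inject₁; fromℕ; fromℕ<; lower₁; combine; quotient; remainder)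
  renaming (zero to fzero; suc to fsuc)
open import Data.Fin.Patterns using (0F; 1F; 2F)
open import Data.Fin.Properties
  using ( toℕ-injective; toℕ-inject₁; toℕ-fromℕ; toℕ-fromℕ<; toℕ<n; fromℕ≢inject₁
        ; inject₁-injective; inject₁-lower₁; combine-remQuot; remQuot-combine; combine-injective
        ; toℕ-combine)
  renaming (_≟_ to _≟ᶠ_)
open import Data.Fin.Subset using (Subset; ∣_∣)
open import Data.List as List using (List; []; _∷_; [_]; filter; cartesianProduct; cartesianProductWith; allFin)
open import Data.List.Membership.Propositional using (_∈_)
open import Data.List.Membership.Propositional.Properties
  using (∈-filter⁺; ∈-filter⁻; ∈-cartesianProduct⁺; ∈-cartesianProductWith⁺; ∈-allFin; ∈-lookup)
open import Data.List.Relation.Unary.All as All using ([]; _∷_)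
open import Data.List.Relation.Unary.AllPairs using ([]; _∷_)
open import Data.List.Relation.Unary.Any using (here; there; index)
open import Data.List.Relation.Unary.Any.Properties using (lookup-index)
open import Data.List.Relation.Unary.Unique.Propositional using (Unique)
import Data.List.Relation.Unary.Unique.Propositional.Properties as Uniqueₚ
open import Data.Nat as ℕ using (ℕ; suc; _+_; _*_; _<_; _≤_; _<?_; s≤s; s≤s⁻¹; z≤n)
open import Data.Nat.Divisibility using (_∣_; divides)
open import Data.Nat.Properties
  using ( 1+n≢n; +-identityʳ; *-zeroʳ; *-identityʳ; *-comm; m≤m+n; m≤m*n; +-monoʳ-<; ≤-trans; <-≤-trans
        ; <⇒≤; <⇒≱; ≤⇒≯; ≤∧≢⇒<; m<n⇒m<1+n; n<1+n; <-irrefl; <-cmp)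
open import Data.Product using (∃; _×_; _,_; proj₁; proj₂; uncurry)
open import Data.Sum using (_⊎_; inj₁; inj₂)
import Data.Sum as Sum
open import Data.Vec using ([]; _∷_; lookup; updateAt; tabulate)
import Data.Vec as Vec
open import Data.Vec.Properties using (∷-injective; tabulate∘lookup; tabulate-cong; lookup∘tabulate)
open import Function using (_∘_)
open import Relation.Binary using (tri<; tri≈; tri>)
open import Relation.Binary.PropositionalEquality
  using (_≡_; _≢_; refl; sym; trans; cong; cong₂; subst; subst₂; module ≡-Reasoning)
open import Relation.Nullary using (Dec; does; yes; no; ¬_)
open import Relation.Nullary.Decidable using (dec-true; dec-false; _×-dec_)

xor-swap : ∀ a b c → (a xor b) xor c ≡ (a xor c) xor b
xor-swap a b c = trans (xor-assoc a b c) (trans (cong (a xor_) (xor-comm b c)) (sym (xor-assoc a c b)))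

toggle : {n : ℕ} → Fin n → Subset n → Subset n
toggle c x = updateAt x c not

Δ-self : {n : ℕ} (x : Subset n) → ∣ x Δ x ∣ ≡ 0
Δ-self []          = refl
Δ-self (true ∷ x)  = Δ-self x
Δ-self (false ∷ x) = Δ-self x

Δ-empty : {n : ℕ} (x y : Subset n) → ∣ x Δ y ∣ ≡ 0 → x ≡ y
Δ-empty []          []          _ = refl
Δ-empty (true ∷ x)  (true ∷ y)  e = cong (true ∷_) (Δ-empty x y e)
Δ-empty (false ∷ x) (false ∷ y) e = cong (false ∷_) (Δ-empty x y e)
Δ-empty (true ∷ x)  (false ∷ y) ()
Δ-empty (false ∷ x) (true ∷ y)  ()

toggle-adjacent : {n : ℕ} (c : Fin n) (x : Subset n) → Adjacent x (toggle c x)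
toggle-adjacent fzero    (true ∷ x)  = cong suc (Δ-self x)
toggle-adjacent fzero    (false ∷ x) = cong suc (Δ-self x)
toggle-adjacent (fsuc c) (true ∷ x)  = toggle-adjacent c x
toggle-adjacent (fsuc c) (false ∷ x) = toggle-adjacent c x

adjacent⇒toggle : {n : ℕ} (x y : Subset n) → Adjacent x y → ∃ λ c → y ≡ toggle c x
adjacent⇒toggle []          []          ()
adjacent⇒toggle (true ∷ x)  (false ∷ y) e = fzero , cong (false ∷_) (sym (Δ-empty x y (cong ℕ.pred e)))
adjacent⇒toggle (false ∷ x) (true ∷ y)  e = fzero , cong (true ∷_) (sym (Δ-empty x y (cong ℕ.pred e)))
adjacent⇒toggle (true ∷ x)  (true ∷ y)  e with c , refl ← adjacent⇒toggle x y e = fsuc c , refl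
adjacent⇒toggle (false ∷ x) (false ∷ y) e with c , refl ← adjacent⇒toggle x y e = fsuc c , refl

vertex-ext : {n : ℕ} {x y : Subset n} → (∀ d → lookup x d ≡ lookup y d) → x ≡ y
vertex-ext {x = x} {y} p = trans (sym (tabulate∘lookup x)) (trans (tabulate-cong p) (tabulate∘lookup y))

lookup-toggle : {n : ℕ} (c d : Fin n) (x : Subset n) → lookup (toggle c x) d ≡ lookup x d xor does (d ≟ᶠ c)
lookup-toggle fzero    fzero    (b ∷ x) = sym (xor-comm b true)
lookup-toggle fzero    (fsuc d) (b ∷ x) = sym (xor-identityʳ _)
lookup-toggle (fsuc c) fzero    (b ∷ x) = sym (xor-identityʳ b)
lookup-toggle (fsuc c) (fsuc d) (b ∷ x) with d ≟ᶠ c | lookup-toggle c d x  -- lets does (fsuc d ≟ᶠ fsuc c) compute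
... | yes _ | e = e
... | no _  | e = e

toggle-involutive : {n : ℕ} (c : Fin n) (x : Subset n) → toggle c (toggle c x) ≡ x
toggle-involutive fzero    (true ∷ x)  = refl
toggle-involutive fzero    (false ∷ x) = refl
toggle-involutive (fsuc c) (b ∷ x)     = cong (b ∷_) (toggle-involutive c x)

toggle-injective : {n : ℕ} (c c′ : Fin n) (x : Subset n) → toggle c x ≡ toggle c′ x → c ≡ c′
toggle-injective fzero    fzero     _           _ = refl
toggle-injective fzero    (fsuc c′) (true ∷ x)  ()
toggle-injective fzero    (fsuc c′) (false ∷ x) ()
toggle-injective (fsuc c) fzero     (true ∷ x)  ()
toggle-injective (fsuc c) fzero     (false ∷ x) ()
toggle-injective (fsuc c) (fsuc c′) (b ∷ x)     e = cong fsuc (toggle-injective c c′ x (cong Vec.tail e))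

toggle-edge : {n : ℕ} (c′ c : Fin n) (w x : Subset n) → SameEdge w (toggle c′ w) x (toggle c x) →
              c′ ≡ c × (w ≡ x ⊎ w ≡ toggle c x)
toggle-edge c′ c w x (inj₁ (refl , e)) = toggle-injective c′ c w e , inj₁ refl
toggle-edge c′ c w x (inj₂ (refl , e)) =
  toggle-injective c′ c w (trans e (sym (toggle-involutive c x))) , inj₂ refl

parityOn : {n : ℕ} → Subset n → Subset n → Bool
parityOn []      []      = false
parityOn (a ∷ w) (b ∷ x) = (a ∧ b) xor parityOn w x

parityOn-toggle : {n : ℕ} (w : Subset n) (c : Fin n) (x : Subset n) →
                  parityOn w (toggle c x) ≡ parityOn w x xor lookup w c
parityOn-toggle (false ∷ w) fzero    (b ∷ x) = sym (xor-identityʳ _)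
parityOn-toggle (true ∷ w)  fzero    (b ∷ x) =
  sym (trans (xor-swap b (parityOn w x) true) (cong (_xor parityOn w x) (xor-comm b true)))
parityOn-toggle (a ∷ w)     (fsuc c) (b ∷ x) =
  trans (cong ((a ∧ b) xor_) (parityOn-toggle w c x)) (sym (xor-assoc (a ∧ b) _ _))

parityOn-cong : {n : ℕ} (w x y : Subset n) → (∀ d → lookup w d ≡ true → lookup x d ≡ lookup y d) →
                parityOn w x ≡ parityOn w y
parityOn-cong []          []      []      _ = refl
parityOn-cong (false ∷ w) (b ∷ x) (b′ ∷ y) p = parityOn-cong w x y (λ d → p (fsuc d))
parityOn-cong (true ∷ w)  (b ∷ x) (b′ ∷ y) p =
  cong₂ _xor_ (p fzero refl) (parityOn-cong w x y (λ d → p (fsuc d)))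

<?-suc : ∀ m t → m ≢ t → does (m <? suc t) ≡ does (m <? t)
<?-suc m t m≢t with m <? t
... | yes m<t = trans (dec-true (m <? suc t) (m<n⇒m<1+n m<t)) (sym (dec-true (m <? t) m<t))
... | no  m≮t = trans (dec-false (m <? suc t) (λ m<1+t → m≮t (≤∧≢⇒< (s≤s⁻¹ m<1+t) m≢t))) (sym (dec-false (m <? t) m≮t))

-- A schedule of length L on the coordinates Fin n assigns to each coordinate
-- the time at which it is flipped; every time below L is used by exactly one
-- coordinate, coordinates with time ≥ L are never flipped.
record Schedule (n L : ℕ) : Set where
  field
    time           : Fin n → ℕ
    cellAt         : Fin L → Fin n
    time-cellAt    : ∀ u → time (cellAt u) ≡ toℕ u
    time-injective : ∀ c d → time c ≡ time d → time c < L → c ≡ d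

module Walk {n L : ℕ} (σ : Schedule n L) where
  open Schedule σ public

  flippedBy : ℕ → Fin n → Bool
  flippedBy t d = does (time d <? t)

  walk : Subset n → ℕ → Subset n
  walk v t = tabulate λ d → lookup v d xor flippedBy t d

  lookup-walk : ∀ v t d → lookup (walk v t) d ≡ lookup v d xor flippedBy t d
  lookup-walk v t d = lookup∘tabulate _ d

  flippedBy-suc : ∀ (u : Fin L) d → flippedBy (suc (toℕ u)) d ≡ flippedBy (toℕ u) d xor does (d ≟ᶠ cellAt u)
  flippedBy-suc u d with d ≟ᶠ cellAt u
  ... | yes refl rewrite time-cellAt u =
        trans (dec-true (toℕ u <? suc (toℕ u)) (n<1+n _)) (cong (_xor true) (sym (dec-false (toℕ u <? toℕ u) (<-irrefl refl))))
  ... | no d≢c = trans (<?-suc (time d) (toℕ u) time≢) (sym (xor-identityʳ _))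
    where
    time≢ : time d ≢ toℕ u
    time≢ e = d≢c (time-injective d (cellAt u) (trans e (sym (time-cellAt u))) (subst (_< L) (sym e) (toℕ<n u)))

  walk-step : ∀ v (u : Fin L) → walk v (suc (toℕ u)) ≡ toggle (cellAt u) (walk v (toℕ u))
  walk-step v u = vertex-ext λ d → begin
    lookup (walk v (suc (toℕ u))) d                                 ≡⟨ lookup-walk v (suc (toℕ u)) d ⟩
    lookup v d xor flippedBy (suc (toℕ u)) d                        ≡⟨ cong (lookup v d xor_) (flippedBy-suc u d) ⟩
    lookup v d xor (flippedBy (toℕ u) d xor does (d ≟ᶠ cellAt u))   ≡⟨ sym (xor-assoc (lookup v d) (flippedBy (toℕ u) d) _) ⟩
    (lookup v d xor flippedBy (toℕ u) d) xor does (d ≟ᶠ cellAt u)   ≡⟨ cong (_xor does (d ≟ᶠ cellAt u)) (sym (lookup-walk v (toℕ u) d)) ⟩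
    lookup (walk v (toℕ u)) d xor does (d ≟ᶠ cellAt u)              ≡⟨ sym (lookup-toggle (cellAt u) d (walk v (toℕ u))) ⟩
    lookup (toggle (cellAt u) (walk v (toℕ u))) d                   ∎
    where open ≡-Reasoning

  -- The coordinate scheduled at time t separates the vertex at time t from
  -- every later vertex of the walk.
  walk-separates : ∀ v {t t′} → t < t′ → t′ ≤ L → walk v t ≢ walk v t′
  walk-separates v {t} {t′} t<t′ t′≤L e = not-¬ refl (begin
    lookup v c                        ≡⟨ sym (xor-identityʳ _) ⟩
    lookup v c xor false              ≡⟨ cong (lookup v c xor_) (sym (dec-false (time c <? t) (<-irrefl time-c))) ⟩
    lookup v c xor flippedBy t c      ≡⟨ sym (lookup-walk v t c) ⟩
    lookup (walk v t) c               ≡⟨ cong (λ w → lookup w c) e ⟩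
    lookup (walk v t′) c              ≡⟨ lookup-walk v t′ c ⟩
    lookup v c xor flippedBy t′ c     ≡⟨ cong (lookup v c xor_) (dec-true (time c <? t′) (subst (_< t′) (sym time-c) t<t′)) ⟩
    lookup v c xor true               ≡⟨ xor-comm (lookup v c) true ⟩
    not (lookup v c)                  ∎)
    where
    open ≡-Reasoning
    t<L = <-≤-trans t<t′ t′≤L
    c = cellAt (fromℕ< t<L)
    time-c : time c ≡ t
    time-c = trans (time-cellAt _) (toℕ-fromℕ< t<L)

  path : Subset n → PathEmbedding L n
  path v = record { vertex = vertex′ ; injective = injective′ ; adjacent = adjacent′ }
    where
    vertex′ : Fin (suc L) → Subset n
    vertex′ u = walk v (toℕ u)
    injective′ : ∀ {u u′} → vertex′ u ≡ vertex′ u′ → u ≡ u′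
    injective′ {u} {u′} e with <-cmp (toℕ u) (toℕ u′)
    ... | tri< lt _ _ = ⊥-elim (walk-separates v lt (s≤s⁻¹ (toℕ<n u′)) e)
    ... | tri≈ _ eq _ = toℕ-injective eq
    ... | tri> _ _ gt = ⊥-elim (walk-separates v gt (s≤s⁻¹ (toℕ<n u)) (sym e))
    adjacent′ : (u : Fin L) → Adjacent (vertex′ (inject₁ u)) (vertex′ (fsuc u))
    adjacent′ u rewrite toℕ-inject₁ u | walk-step v u = toggle-adjacent (cellAt u) (walk v (toℕ u))

  walk-twice : ∀ v t → walk (walk v t) t ≡ v
  walk-twice v t = vertex-ext λ d → begin
    lookup (walk (walk v t) t) d                        ≡⟨ lookup-walk (walk v t) t d ⟩
    lookup (walk v t) d xor flippedBy t d               ≡⟨ cong (_xor flippedBy t d) (lookup-walk v t d) ⟩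
    (lookup v d xor flippedBy t d) xor flippedBy t d    ≡⟨ xor-assoc (lookup v d) _ _ ⟩
    lookup v d xor (flippedBy t d xor flippedBy t d)    ≡⟨ cong (lookup v d xor_) (xor-same (flippedBy t d)) ⟩
    lookup v d xor false                                ≡⟨ xor-identityʳ _ ⟩
    lookup v d                                          ∎
    where open ≡-Reasoning

  walk-toggle : ∀ c v t → walk (toggle c v) t ≡ toggle c (walk v t)
  walk-toggle c v t = vertex-ext λ d → begin
    lookup (walk (toggle c v) t) d                 ≡⟨ lookup-walk (toggle c v) t d ⟩
    lookup (toggle c v) d xor flippedBy t d        ≡⟨ cong (_xor flippedBy t d) (lookup-toggle c d v) ⟩
    (lookup v d xor does (d ≟ᶠ c)) xor flippedBy t d ≡⟨ xor-swap (lookup v d) (does (d ≟ᶠ c)) (flippedBy t d) ⟩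
    (lookup v d xor flippedBy t d) xor does (d ≟ᶠ c) ≡⟨ cong (_xor does (d ≟ᶠ c)) (sym (lookup-walk v t d)) ⟩
    lookup (walk v t) d xor does (d ≟ᶠ c)          ≡⟨ sym (lookup-toggle c d (walk v t)) ⟩
    lookup (toggle c (walk v t)) d                 ∎
    where open ≡-Reasoning

  walk-zero : ∀ v → walk v 0 ≡ v
  walk-zero v = vertex-ext λ d → trans (lookup-walk v 0 d) (xor-identityʳ (lookup v d))

  walk-agree : ∀ v t t′ d → (time d < t × time d < t′) ⊎ (t ≤ time d × t′ ≤ time d) →
               lookup (walk v t) d ≡ lookup (walk v t′) d
  walk-agree v t t′ d side = begin
    lookup (walk v t) d              ≡⟨ lookup-walk v t d ⟩
    lookup v d xor flippedBy t d     ≡⟨ cong (lookup v d xor_) (same side) ⟩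
    lookup v d xor flippedBy t′ d    ≡⟨ sym (lookup-walk v t′ d) ⟩
    lookup (walk v t′) d             ∎
    where
    open ≡-Reasoning
    same : (time d < t × time d < t′) ⊎ (t ≤ time d × t′ ≤ time d) → flippedBy t d ≡ flippedBy t′ d
    same (inj₁ (lt , lt′)) = trans (dec-true (time d <? t) lt) (sym (dec-true (time d <? t′) lt′))
    same (inj₂ (le , le′)) = trans (dec-false (time d <? t) (≤⇒≯ le)) (sym (dec-false (time d <? t′) (≤⇒≯ le′)))

  -- The edges of a walk: {x, x Δ {c}} lies on the walk from v iff c is
  -- scheduled and v is one of the two starts that are at x or at x Δ {c} at
  -- time (time c)  (edge⇒through and through⇒edge).
  Through : Subset n → Subset n → Fin n → Set
  Through v x c = time c < L × (v ≡ walk x (time c) ⊎ v ≡ toggle c (walk x (time c)))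

  start-of : ∀ v t y → walk v t ≡ y → v ≡ walk y t
  start-of v t y e = trans (sym (walk-twice v t)) (cong (λ w → walk w t) e)

  edge⇒through : ∀ v x c → EdgeOf (path v) x (toggle c x) → Through v x c
  edge⇒through v x c (u , same)
    with refl , ends ← toggle-edge (cellAt u) c (walk v (toℕ u)) x
           (subst₂ (λ y z → SameEdge y z x (toggle c x)) (cong (walk v) (toℕ-inject₁ u)) (walk-step v u) same)
    = subst (_< L) (sym (time-cellAt u)) (toℕ<n u) , starts ends
    where
    at-u : walk v (time c) ≡ walk v (toℕ u)
    at-u = cong (walk v) (time-cellAt u)
    starts : walk v (toℕ u) ≡ x ⊎ walk v (toℕ u) ≡ toggle c x → v ≡ walk x (time c) ⊎ v ≡ toggle c (walk x (time c))
    starts (inj₁ w≡x)  = inj₁ (start-of v (time c) x (trans at-u w≡x))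
    starts (inj₂ w≡cx) = inj₂ (trans (start-of v (time c) (toggle c x) (trans at-u w≡cx)) (walk-toggle c x (time c)))

  through-vertex : ∀ v x c → Through v x c → walk v (time c) ≡ x ⊎ walk v (time c) ≡ toggle c x
  through-vertex v x c (_ , inj₁ refl) = inj₁ (walk-twice x (time c))
  through-vertex v x c (_ , inj₂ refl) =
    inj₂ (trans (walk-toggle c (walk x (time c)) (time c)) (cong (toggle c) (walk-twice x (time c))))

  through⇒edge : ∀ v x c → Through v x c → EdgeOf (path v) x (toggle c x)
  through⇒edge v x c through@(lt , _) = u , same (through-vertex v x c through)
    where
    u = fromℕ< lt
    u-time : time (cellAt u) ≡ time c
    u-time = trans (time-cellAt u) (toℕ-fromℕ< lt)
    before : walk v (toℕ (inject₁ u)) ≡ walk v (time c)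
    before = cong (walk v) (trans (toℕ-inject₁ u) (toℕ-fromℕ< lt))
    after : walk v (suc (toℕ u)) ≡ toggle c (walk v (time c))
    after = trans (walk-step v u)
      (cong₂ toggle (time-injective (cellAt u) c u-time (subst (_< L) (sym u-time) lt)) (cong (walk v) (toℕ-fromℕ< lt)))
    same : walk v (time c) ≡ x ⊎ walk v (time c) ≡ toggle c x →
           SameEdge (walk v (toℕ (inject₁ u))) (walk v (suc (toℕ u))) x (toggle c x)
    same (inj₁ e) = inj₁ (trans before e , trans after (cong (toggle c) e))
    same (inj₂ e) = inj₂ (trans before e , trans after (trans (cong (toggle c) e) (toggle-involutive c x)))

allSubsets : ∀ n → List (Subset n)
allSubsets 0       = [ [] ]
allSubsets (suc n) = cartesianProductWith _∷_ (true ∷ [ false ]) (allSubsets n)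

∈-allSubsets : ∀ {n} (x : Subset n) → x ∈ allSubsets n
∈-allSubsets []          = here refl
∈-allSubsets (true ∷ x)  = ∈-cartesianProductWith⁺ _∷_ {xs = true ∷ [ false ]} (here refl) (∈-allSubsets x)
∈-allSubsets (false ∷ x) = ∈-cartesianProductWith⁺ _∷_ {xs = true ∷ [ false ]} (there (here refl)) (∈-allSubsets x)

allSubsets-unique : ∀ n → Unique (allSubsets n)
allSubsets-unique 0       = [] ∷ []
allSubsets-unique (suc n) =
  Uniqueₚ.cartesianProductWith⁺ _∷_ ∷-injective (((λ ()) ∷ []) ∷ [] ∷ []) (allSubsets-unique n)

unique-lookup : ∀ {A : Set} {xs : List A} → Unique xs → ∀ i j → List.lookup xs i ≡ List.lookup xs j → i ≡ j
unique-lookup (_ ∷ _)    fzero    fzero    _ = refl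
unique-lookup (x∉ ∷ _)   fzero    (fsuc j) e = ⊥-elim (All.lookup x∉ (∈-lookup j) e)
unique-lookup (x∉ ∷ _)   (fsuc i) fzero    e = ⊥-elim (All.lookup x∉ (∈-lookup i) (sym e))
unique-lookup (_ ∷ uniq) (fsuc i) (fsuc j) e = cong fsuc (unique-lookup uniq i j e)

pathDivides-fromList : ∀ {A : Set} {L n} (labels : List A) → Unique labels → (θ : A → PathEmbedding L n) →
  (∀ x y → Adjacent x y → ∃ λ ℓ → ℓ ∈ labels × EdgeOf (θ ℓ) x y) →
  (∀ x y ℓ ℓ′ → ℓ ∈ labels → ℓ′ ∈ labels → Adjacent x y → EdgeOf (θ ℓ) x y → EdgeOf (θ ℓ′) x y → ℓ ≡ ℓ′) →
  PathDividesCube L n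
pathDivides-fromList labels uniq θ cover disjoint = List.length labels , θ ∘ List.lookup labels , λ x y adj →
  let ℓ , ℓ∈ , on-ℓ = cover x y adj
  in (index ℓ∈ , subst (λ ℓ′ → EdgeOf (θ ℓ′) x y) (lookup-index ℓ∈) on-ℓ) ,
     λ j j′ on-j on-j′ → unique-lookup uniq j j′ (disjoint x y _ _ (∈-lookup j) (∈-lookup j′) adj on-j on-j′)

record Derangement (m : ℕ) : Set where
  field
    next            : Fin m → Fin m
    next-injective  : ∀ a b → next a ≡ next b → a ≡ b
    next-surjective : ∀ i → ∃ λ a → next a ≡ i
    next-moves      : ∀ a → next a ≢ a

-- Coordinates of Q_{m·k} arranged in an m × k grid; the path of type a first
-- flips row a from left to right, then row next a.
module Grid {m : ℕ} (k : ℕ) (D : Derangement m) where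
  open Derangement D

  row : Fin (m * k) → Fin m
  row = quotient k

  col : Fin (m * k) → Fin k
  col = remainder {m} k

  cell-ext : ∀ {c d} → row c ≡ row d → col c ≡ col d → c ≡ d
  cell-ext {c} {d} r c′ = trans (sym (combine-remQuot {m} k c)) (trans (cong₂ combine r c′) (combine-remQuot {m} k d))

  data Position (a i : Fin m) : Set where
    first  : i ≡ a → Position a i
    second : i ≡ next a → Position a i
    later  : i ≢ a → i ≢ next a → Position a i

  position : ∀ a i → Position a i
  position a i with i ≟ᶠ a | i ≟ᶠ next a
  ... | yes e  | _      = first e
  ... | no _   | yes e  = second e
  ... | no ne  | no ne′ = later ne ne′

  phase : ∀ {a i} → Position a i → Fin 3
  phase (first _)   = 0F
  phase (second _)  = 1F
  phase (later _ _) = 2F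

  -- The time at which cell (i , j) is flipped: row a during [0, k),
  -- row next a during [k, 2k), the other rows never (time ≥ 2k).
  clock : ∀ {a i} → Position a i → Fin k → ℕ
  clock p j = toℕ (combine (phase p) j)

  clock-lower : ∀ {a i} (p : Position a i) j → k * toℕ (phase p) ≤ clock p j
  clock-lower p j = subst (k * toℕ (phase p) ≤_) (sym (toℕ-combine (phase p) j)) (m≤m+n _ _)

  clock-upper : ∀ {a i} (p : Position a i) j → clock p j < k * toℕ (phase p) + k
  clock-upper p j = subst (_< k * toℕ (phase p) + k) (sym (toℕ-combine (phase p) j)) (+-monoʳ-< _ (toℕ<n j))

  clock-later : ∀ {a i} (i≢a : i ≢ a) (i≢na : i ≢ next a) j → 2 * k ≤ clock (later i≢a i≢na) j
  clock-later i≢a i≢na j = subst (_≤ clock (later i≢a i≢na) j) (*-comm k 2) (clock-lower (later i≢a i≢na) j)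

  clock-first : ∀ {a i} → i ≡ a → (p : Position a i) (j : Fin k) → clock p j < k
  clock-first i≡a (first _)     j = subst (clock (first i≡a) j <_) (cong (_+ k) (*-zeroʳ k)) (clock-upper (first i≡a) j)
  clock-first i≡a (second i≡na) j = ⊥-elim (next-moves _ (trans (sym i≡na) i≡a))
  clock-first i≡a (later i≢a _) j = ⊥-elim (i≢a i≡a)

  clock-notFirst : ∀ {a i} → i ≢ a → (p : Position a i) (j : Fin k) → k ≤ clock p j
  clock-notFirst i≢a (first i≡a)  j = ⊥-elim (i≢a i≡a)
  clock-notFirst i≢a p@(second _) j = subst (_≤ clock p j) (*-identityʳ k) (clock-lower p j)
  clock-notFirst i≢a p@(later _ _) j = ≤-trans (m≤m*n k 2) (clock-lower p j)

  clock-notSecond : ∀ {a i} → i ≢ next a → (p : Position a i) (j : Fin k) → clock p j < k ⊎ 2 * k ≤ clock p j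
  clock-notSecond i≢na p@(first i≡a)  j = inj₁ (clock-first i≡a p j)
  clock-notSecond i≢na (second i≡na)  j = ⊥-elim (i≢na i≡na)
  clock-notSecond i≢na (later i≢a _)  j = inj₂ (clock-later i≢a i≢na j)

  clock-second : ∀ {a i} → i ≡ next a → (p : Position a i) (j : Fin k) → clock p j < 2 * k
  clock-second i≡na p@(second _) j = subst (clock p j <_) k+k (clock-upper p j)
    where
    k+k : k * 1 + k ≡ 2 * k
    k+k = trans (cong (_+ k) (*-identityʳ k)) (cong (k +_) (sym (+-identityʳ k)))
  clock-second i≡na (first i≡a)   j = ⊥-elim (next-moves _ (trans (sym i≡na) i≡a))
  clock-second i≡na (later _ i≢na) j = ⊥-elim (i≢na i≡na)

  -- Below time 2k the clock determines the cell (different phases are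
  -- excluded by the injectivity of combine).
  clock-injective : ∀ {a i i′} (p : Position a i) (p′ : Position a i′) j j′ →
                    clock p j ≡ clock p′ j′ → clock p j < 2 * k → i ≡ i′ × j ≡ j′
  clock-injective p p′ j j′ e lt with p | p′ | combine-injective (phase p) j (phase p′) j′ (toℕ-injective e)
  ... | first i≡a   | first i′≡a   | _ , j≡j′ = trans i≡a (sym i′≡a) , j≡j′
  ... | second i≡na | second i′≡na | _ , j≡j′ = trans i≡na (sym i′≡na) , j≡j′
  ... | later i≢a i≢na | _         | _        = ⊥-elim (<⇒≱ lt (clock-later i≢a i≢na j))

  rowAt : Fin m → Fin 2 → Fin m
  rowAt a 0F = a
  rowAt a 1F = next a

  phase-rowAt : ∀ a q → phase (position a (rowAt a q)) ≡ inject₁ q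
  phase-rowAt a q with q | position a (rowAt a q)
  ... | 0F | first _      = refl
  ... | 0F | second a≡na  = ⊥-elim (next-moves a (sym a≡na))
  ... | 0F | later a≢a _  = ⊥-elim (a≢a refl)
  ... | 1F | first na≡a   = ⊥-elim (next-moves a na≡a)
  ... | 1F | second _     = refl
  ... | 1F | later _ na≢na = ⊥-elim (na≢na refl)

  -- The schedule of the path of type a: at time u = k·q + r (q < 2, r < k)
  -- it flips the cell in column r of row rowAt a q.
  schedule : Fin m → Schedule (m * k) (2 * k)
  schedule a = record
    { time           = time
    ; cellAt         = cellAt
    ; time-cellAt    = time-cellAt
    ; time-injective = λ c d e lt → let r , c′ = clock-injective (position a (row c)) (position a (row d)) (col c) (col d) e lt
                                    in cell-ext r c′
    }
    where
    time : Fin (m * k) → ℕ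
    time d = clock (position a (row d)) (col d)
    cellAt : Fin (2 * k) → Fin (m * k)
    cellAt u = combine (rowAt a (quotient k u)) (remainder {2} k u)
    time-cellAt : ∀ u → time (cellAt u) ≡ toℕ u
    time-cellAt u = begin
      clock (position a (row (cellAt u))) (col (cellAt u))
        ≡⟨ cong₂ (λ i j → clock (position a i) j) (cong proj₁ (remQuot-combine {m} {k} (rowAt a q) r)) (cong proj₂ (remQuot-combine {m} {k} (rowAt a q) r)) ⟩
      toℕ (combine (phase (position a (rowAt a q))) r) ≡⟨ cong (λ ph → toℕ (combine ph r)) (phase-rowAt a q) ⟩
      toℕ (combine (inject₁ q) r)                      ≡⟨ toℕ-combine (inject₁ q) r ⟩
      k * toℕ (inject₁ q) + toℕ r                      ≡⟨ cong (λ z → k * z + toℕ r) (toℕ-inject₁ q) ⟩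
      k * toℕ q + toℕ r                                ≡⟨ sym (toℕ-combine q r) ⟩
      toℕ (combine q r)                                ≡⟨ cong toℕ (combine-remQuot {2} k u) ⟩
      toℕ u                                            ∎
      where
      open ≡-Reasoning
      q = quotient {2} k u
      r = remainder {2} k u

  module Route (a : Fin m) = Walk (schedule a)
  open Route using (walk; path; Through)

  offRow : Fin m → Subset (m * k)
  offRow i = tabulate λ d → not (does (row d ≟ᶠ i))

  outerParity : Fin m → Subset (m * k) → Bool
  outerParity i = parityOn (offRow i)

  lookup-offRow : ∀ i d → lookup (offRow i) d ≡ not (does (row d ≟ᶠ i))
  lookup-offRow i d = lookup∘tabulate _ d

  outerParity-toggle : ∀ i c x → outerParity i (toggle c x) ≡ outerParity i x xor not (does (row c ≟ᶠ i))
  outerParity-toggle i c x = trans (parityOn-toggle (offRow i) c x) (cong (outerParity i x xor_) (lookup-offRow i c))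

  outerParity-inRow : ∀ {i c} x → row c ≡ i → outerParity i (toggle c x) ≡ outerParity i x
  outerParity-inRow {i} {c} x r≡i = begin
    outerParity i (toggle c x)                    ≡⟨ outerParity-toggle i c x ⟩
    outerParity i x xor not (does (row c ≟ᶠ i))   ≡⟨ cong (λ b → outerParity i x xor not b) (dec-true (row c ≟ᶠ i) r≡i) ⟩
    outerParity i x xor false                     ≡⟨ xor-identityʳ _ ⟩
    outerParity i x                               ∎
    where open ≡-Reasoning

  outerParity-offRow : ∀ {i c} x → row c ≢ i → outerParity i (toggle c x) ≡ not (outerParity i x)
  outerParity-offRow {i} {c} x r≢i = begin
    outerParity i (toggle c x)                    ≡⟨ outerParity-toggle i c x ⟩
    outerParity i x xor not (does (row c ≟ᶠ i))   ≡⟨ cong (λ b → outerParity i x xor not b) (dec-false (row c ≟ᶠ i) r≢i) ⟩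
    outerParity i x xor true                      ≡⟨ xor-comm _ true ⟩
    not (outerParity i x)                         ∎
    where open ≡-Reasoning

  offRow-member : ∀ {i} d → lookup (offRow i) d ≡ true → row d ≢ i
  offRow-member {i} d e r≡i = not-¬ refl (begin
    true                          ≡⟨ sym e ⟩
    lookup (offRow i) d           ≡⟨ lookup-offRow i d ⟩
    not (does (row d ≟ᶠ i))       ≡⟨ cong not (dec-true (row d ≟ᶠ i) r≡i) ⟩
    false                         ∎)
    where open ≡-Reasoning

  first-half : ∀ a v {t} → t ≤ k → outerParity a (walk a v t) ≡ outerParity a v
  first-half a v {t} t≤k = trans
    (parityOn-cong (offRow a) (walk a v t) (walk a v 0)
      (λ d in-mask → Route.walk-agree a v t 0 d (inj₂ (≤-trans t≤k (later-than-k d in-mask) , z≤n))))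
    (cong (outerParity a) (Route.walk-zero a v))
    where
    later-than-k : ∀ d → lookup (offRow a) d ≡ true → k ≤ Route.time a d
    later-than-k d in-mask = clock-notFirst (offRow-member d in-mask) (position a (row d)) (col d)

  second-half : ∀ a v {t} → k ≤ t → t ≤ 2 * k → outerParity (next a) (walk a v t) ≡ outerParity (next a) (walk a v k)
  second-half a v {t} k≤t t≤2k = parityOn-cong (offRow (next a)) (walk a v t) (walk a v k)
    (λ d in-mask → Route.walk-agree a v t k d (sides (clock-notSecond (offRow-member d in-mask) (position a (row d)) (col d))))
    where
    sides : ∀ {x} → x < k ⊎ 2 * k ≤ x → (x < t × x < k) ⊎ (t ≤ x × k ≤ x)
    sides (inj₁ x<k)  = inj₁ (<-≤-trans x<k k≤t , x<k)
    sides (inj₂ 2k≤x) = inj₂ (≤-trans t≤2k 2k≤x , ≤-trans (m≤m+n k _) 2k≤x)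

  scheduled-rows : ∀ a c → Route.time a c < 2 * k →
                   (row c ≡ a × Route.time a c < k) ⊎ (row c ≡ next a × k ≤ Route.time a c)
  scheduled-rows a c = scheduled (position a (row c)) (col c)
    where
    scheduled : ∀ {i} (p : Position a i) j → clock p j < 2 * k → (i ≡ a × clock p j < k) ⊎ (i ≡ next a × k ≤ clock p j)
    scheduled p@(first i≡a)   j _  = inj₁ (i≡a , clock-first i≡a p j)
    scheduled p@(second i≡na) j _  = inj₂ (i≡na , clock-notFirst (λ i≡a → next-moves a (trans (sym i≡na) i≡a)) p j)
    scheduled (later i≢a i≢na) j lt = ⊥-elim (<⇒≱ lt (clock-later i≢a i≢na j))

  Valid : Fin m → Subset (m * k) → Set
  Valid a v = outerParity a v ≡ false × outerParity (next a) (walk a v k) ≡ true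

  -- Toggling in direction c does not change the parity outside row c, so
  -- both ends of an edge have the same one.
  parity-at-edge : ∀ a v x c → Through a v x c →
                   outerParity (row c) (walk a v (Route.time a c)) ≡ outerParity (row c) x
  parity-at-edge a v x c through with Route.through-vertex a v x c through
  ... | inj₁ e = cong (outerParity (row c)) e
  ... | inj₂ e = trans (cong (outerParity (row c)) e) (outerParity-inRow x refl)

  -- The parity outside row c of an edge in direction c reveals in which half
  -- of a valid path it lies.
  edge-type : ∀ {a v} x c → Valid a v → Through a v x c →
              (row c ≡ a × outerParity (row c) x ≡ false) ⊎ (row c ≡ next a × outerParity (row c) x ≡ true)
  edge-type {a} {v} x c (even , odd) through@(lt , _) with scheduled-rows a c lt
  ... | inj₁ (r≡a , early) = inj₁ (r≡a , (begin
    outerParity (row c) x                    ≡⟨ sym (parity-at-edge a v x c through) ⟩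
    outerParity (row c) (walk a v t)         ≡⟨ cong (λ i → outerParity i (walk a v t)) r≡a ⟩
    outerParity a (walk a v t)               ≡⟨ first-half a v (<⇒≤ early) ⟩
    outerParity a v                          ≡⟨ even ⟩
    false                                    ∎))
    where
    open ≡-Reasoning
    t = Route.time a c
  ... | inj₂ (r≡na , late) = inj₂ (r≡na , (begin
    outerParity (row c) x                    ≡⟨ sym (parity-at-edge a v x c through) ⟩
    outerParity (row c) (walk a v t)         ≡⟨ cong (λ i → outerParity i (walk a v t)) r≡na ⟩
    outerParity (next a) (walk a v t)        ≡⟨ second-half a v late (<⇒≤ lt) ⟩
    outerParity (next a) (walk a v k)        ≡⟨ odd ⟩
    true                                     ∎))
    where
    open ≡-Reasoning
    t = Route.time a c

  unique-type : ∀ {a a′ v v′} x c → Valid a v → Valid a′ v′ → Through a v x c → Through a′ v′ x c → a ≡ a′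
  unique-type {a} {a′} x c valid valid′ through through′ with edge-type x c valid through | edge-type x c valid′ through′
  ... | inj₁ (r≡a , _)     | inj₁ (r≡a′ , _)     = trans (sym r≡a) r≡a′
  ... | inj₂ (r≡na , _)    | inj₂ (r≡na′ , _)    = next-injective a a′ (trans (sym r≡na) r≡na′)
  ... | inj₁ (_ , even)    | inj₂ (_ , odd)      with () ← trans (sym even) odd
  ... | inj₂ (_ , odd)     | inj₁ (_ , even)     with () ← trans (sym even) odd

  toggle-invalidates : ∀ {a v c} → row c ≡ a ⊎ row c ≡ next a → Valid a v → ¬ Valid a (toggle c v)
  toggle-invalidates {a} {v} {c} (inj₁ r≡a) (_ , odd) (_ , odd′) = not-¬ refl (begin
    true                                           ≡⟨ sym odd′ ⟩
    outerParity (next a) (walk a (toggle c v) k)   ≡⟨ cong (outerParity (next a)) (Route.walk-toggle a c v k) ⟩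
    outerParity (next a) (toggle c (walk a v k))   ≡⟨ outerParity-offRow (walk a v k) (λ r≡na → next-moves a (trans (sym r≡na) r≡a)) ⟩
    not (outerParity (next a) (walk a v k))        ≡⟨ cong not odd ⟩
    false                                          ∎)
    where open ≡-Reasoning
  toggle-invalidates {a} {v} {c} (inj₂ r≡na) (even , _) (even′ , _) = not-¬ refl (begin
    false                                          ≡⟨ sym even′ ⟩
    outerParity a (toggle c v)                     ≡⟨ outerParity-offRow v (λ r≡a → next-moves a (trans (sym r≡na) r≡a)) ⟩
    not (outerParity a v)                          ≡⟨ cong not even ⟩
    true                                           ∎)
    where open ≡-Reasoning

  unique-start : ∀ {a v v′} x c → Valid a v → Valid a v′ → Through a v x c → Through a v′ x c → v ≡ v′
  unique-start {a} {v} {v′} x c valid valid′ (lt , start) (_ , start′) = same start start′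
    where
    s = walk a x (Route.time a c)
    rows : row c ≡ a ⊎ row c ≡ next a
    rows = Sum.map proj₁ proj₁ (scheduled-rows a c lt)
    same : v ≡ s ⊎ v ≡ toggle c s → v′ ≡ s ⊎ v′ ≡ toggle c s → v ≡ v′
    same (inj₁ e) (inj₁ e′) = trans e (sym e′)
    same (inj₂ e) (inj₂ e′) = trans e (sym e′)
    same (inj₁ e) (inj₂ e′) = ⊥-elim (toggle-invalidates rows valid (subst (Valid a) (trans e′ (cong (toggle c) (sym e))) valid′))
    same (inj₂ e) (inj₁ e′) = ⊥-elim (toggle-invalidates rows valid′ (subst (Valid a) (trans e (cong (toggle c) (sym e′))) valid))

  unique-label : ∀ {a a′ v v′} x c → Valid a v → Valid a′ v′ → Through a v x c → Through a′ v′ x c → (a , v) ≡ (a′ , v′)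
  unique-label x c valid valid′ through through′ with refl ← unique-type x c valid valid′ through through′ =
    cong (_ ,_) (unique-start x c valid valid′ through through′)

  -- An edge in direction c with even parity outside row c lies on a valid
  -- path of type row c: start from x walked back to time (time c), toggled at
  -- c if needed to fix the parity outside the second row.
  first-half-start : ∀ x c → outerParity (row c) x ≡ false → ∃ λ v → Valid (row c) v × Through (row c) v x c
  first-half-start x c even-x = choose _ refl
    where
    open ≡-Reasoning
    a = row c
    t = Route.time a c
    early : t < k
    early = clock-first refl (position a a) (col c)
    lt : t < 2 * k
    lt = <-≤-trans early (m≤m+n k _)
    s = walk a x t
    even-s : outerParity a s ≡ false
    even-s = begin
      outerParity a s                ≡⟨ sym (first-half a s (<⇒≤ early)) ⟩
      outerParity a (walk a s t)     ≡⟨ cong (outerParity a) (Route.walk-twice a x t) ⟩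
      outerParity a x                ≡⟨ even-x ⟩
      false                          ∎
    choose : ∀ b → outerParity (next a) (walk a s k) ≡ b → ∃ λ v → Valid a v × Through a v x c
    choose true  odd-s  = s , (even-s , odd-s) , (lt , inj₁ refl)
    choose false even-s′ = toggle c s , (trans (outerParity-inRow s refl) even-s , odd-toggled) , (lt , inj₂ refl)
      where
      odd-toggled : outerParity (next a) (walk a (toggle c s) k) ≡ true
      odd-toggled = begin
        outerParity (next a) (walk a (toggle c s) k)  ≡⟨ cong (outerParity (next a)) (Route.walk-toggle a c s k) ⟩
        outerParity (next a) (toggle c (walk a s k))  ≡⟨ outerParity-offRow (walk a s k) (λ a≡na → next-moves a (sym a≡na)) ⟩
        not (outerParity (next a) (walk a s k))       ≡⟨ cong not even-s′ ⟩
        true                                          ∎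

  second-half-start : ∀ a x c → next a ≡ row c → outerParity (row c) x ≡ true → ∃ λ v → Valid a v × Through a v x c
  second-half-start a x c na≡r odd-x = choose _ refl
    where
    open ≡-Reasoning
    t = Route.time a c
    r≢a : row c ≢ a
    r≢a r≡a = next-moves a (trans na≡r r≡a)
    late : k ≤ t
    late = clock-notFirst r≢a (position a (row c)) (col c)
    lt : t < 2 * k
    lt = clock-second (sym na≡r) (position a (row c)) (col c)
    s = walk a x t
    odd-s : outerParity (next a) (walk a s k) ≡ true
    odd-s = begin
      outerParity (next a) (walk a s k)   ≡⟨ sym (second-half a s late (<⇒≤ lt)) ⟩
      outerParity (next a) (walk a s t)   ≡⟨ cong (outerParity (next a)) (Route.walk-twice a x t) ⟩
      outerParity (next a) x              ≡⟨ cong (λ i → outerParity i x) na≡r ⟩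
      outerParity (row c) x               ≡⟨ odd-x ⟩
      true                                ∎
    odd-toggled : outerParity (next a) (walk a (toggle c s) k) ≡ true
    odd-toggled = begin
      outerParity (next a) (walk a (toggle c s) k)  ≡⟨ cong (outerParity (next a)) (Route.walk-toggle a c s k) ⟩
      outerParity (next a) (toggle c (walk a s k))  ≡⟨ outerParity-inRow (walk a s k) (sym na≡r) ⟩
      outerParity (next a) (walk a s k)             ≡⟨ odd-s ⟩
      true                                          ∎
    choose : ∀ b → outerParity a s ≡ b → ∃ λ v → Valid a v × Through a v x c
    choose false even-s = s , (even-s , odd-s) , (lt , inj₁ refl)
    choose true  odd-s′ = toggle c s , (trans (outerParity-offRow s r≢a) (cong not odd-s′) , odd-toggled) , (lt , inj₂ refl)

  exists-valid : ∀ x c → ∃ λ a → ∃ λ v → Valid a v × Through a v x c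
  exists-valid x c = classify _ refl
    where
    classify : ∀ b → outerParity (row c) x ≡ b → ∃ λ a → ∃ λ v → Valid a v × Through a v x c
    classify false even-x = row c , first-half-start x c even-x
    classify true  odd-x  = let a , na≡r = next-surjective (row c) in a , second-half-start a x c na≡r odd-x

  valid? : ∀ a v → Dec (Valid a v)
  valid? a v = (outerParity a v Bool.≟ false) ×-dec (outerParity (next a) (walk a v k) Bool.≟ true)

  labels : List (Fin m × Subset (m * k))
  labels = filter (uncurry valid?) (cartesianProduct (allFin m) (allSubsets (m * k)))

  labels-unique : Unique labels
  labels-unique = Uniqueₚ.filter⁺ (uncurry valid?) (Uniqueₚ.cartesianProduct⁺ (Uniqueₚ.allFin⁺ m) (allSubsets-unique (m * k)))

  valid-label : ∀ {a v} → (a , v) ∈ labels → Valid a v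
  valid-label ℓ∈ = proj₂ (∈-filter⁻ (uncurry valid?) {xs = cartesianProduct (allFin m) (allSubsets (m * k))} ℓ∈)

  pathsDivideGrid : PathDividesCube (2 * k) (m * k)
  pathsDivideGrid = pathDivides-fromList labels labels-unique (uncurry path) cover disjoint
    where
    cover : ∀ x y → Adjacent x y → ∃ λ ℓ → ℓ ∈ labels × EdgeOf (uncurry path ℓ) x y
    cover x y adj with c , refl ← adjacent⇒toggle x y adj with a , v , valid , through ← exists-valid x c =
      (a , v) , ∈-filter⁺ (uncurry valid?) (∈-cartesianProduct⁺ (∈-allFin a) (∈-allSubsets v)) valid ,
      Route.through⇒edge a v x c through
    disjoint : ∀ x y ℓ ℓ′ → ℓ ∈ labels → ℓ′ ∈ labels → Adjacent x y →
               EdgeOf (uncurry path ℓ) x y → EdgeOf (uncurry path ℓ′) x y → ℓ ≡ ℓ′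
    disjoint x y (a , v) (a′ , v′) ℓ∈ ℓ′∈ adj on on′ with c , refl ← adjacent⇒toggle x y adj =
      unique-label x c (valid-label ℓ∈) (valid-label ℓ′∈)
        (Route.edge⇒through a v x c on) (Route.edge⇒through a′ v′ x c on′)

cyclicShift : ∀ m → Derangement (suc (suc m))
cyclicShift m = record
  { next            = shift
  ; next-injective  = shift-injective
  ; next-surjective = shift-surjective
  ; next-moves      = shift-moves
  }
  where
  shift : Fin (suc (suc m)) → Fin (suc (suc m))
  shift fzero    = fromℕ (suc m)
  shift (fsuc i) = inject₁ i

  shift-injective : ∀ i j → shift i ≡ shift j → i ≡ j
  shift-injective fzero    fzero    _ = refl
  shift-injective fzero    (fsuc j) e = ⊥-elim (fromℕ≢inject₁ e)
  shift-injective (fsuc i) fzero    e = ⊥-elim (fromℕ≢inject₁ (sym e))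
  shift-injective (fsuc i) (fsuc j) e = cong fsuc (inject₁-injective e)

  shift-surjective : ∀ j → ∃ λ i → shift i ≡ j
  shift-surjective j with suc m ℕ.≟ toℕ j
  ... | yes last   = fzero , toℕ-injective (trans (toℕ-fromℕ (suc m)) last)
  ... | no  ¬last  = fsuc (lower₁ j ¬last) , inject₁-lower₁ j ¬last

  shift-moves : ∀ i → shift i ≢ i
  shift-moves fzero    ()
  shift-moves (fsuc i) e = 1+n≢n (sym (trans (sym (toℕ-inject₁ i)) (cong toℕ e)))

pathDividesCube-multiple : ∀ q k → 2 ≤ q → PathDividesCube (2 * k) (q * k)
pathDividesCube-multiple 0             k ()
pathDividesCube-multiple 1             k (s≤s ())
pathDividesCube-multiple (suc (suc q)) k _ = Grid.pathsDivideGrid k (cyclicShift q)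

quotient-≥2 : ∀ q k → k < q * k → 2 ≤ q
quotient-≥2 0             k ()
quotient-≥2 1             k k<k = ⊥-elim (<-irrefl (sym (+-identityʳ k)) k<k)
quotient-≥2 (suc (suc q)) k _   = s≤s (s≤s z≤n)

corollary5 : (n k : ℕ) → 2 ∣ n → 0 < n → 0 < k → k < n → k ∣ n →
    PathDividesCube (2 * k) n
corollary5 n k _ _ _ k<n (divides q n≡q*k) =
  subst (PathDividesCube (2 * k)) (sym n≡q*k) (pathDividesCube-multiple q k (quotient-≥2 q k (subst (k <_) n≡q*k k<n)))
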